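{- For $n\ge1$ let $P_n(x,z)=\sum_{\sigma\in\mathcal{S}_n}x^{\overrightarrow{des}_E(\sigma)}z^{\chi(\sigma_1\text{ even})}$. Then $P_1(x,z)=1$, $P_2(x,z)=1+z$, and for all $n\ge1$, $$P_{2n+1}(x,z)=x(1-x)\frac{\partial}{\partial x}P_{2n}(x,z)+x(1-z)\frac{\partial}{\partial z}P_{2n}(x,z)+(1+n(1+x))P_{2n}(x,z),$$ $$P_{2n+2}(x,z)=x(1-x)\frac{\partial}{\partial x}P_{2n+1}(x,z)+z(1-z)\frac{\partial}{\partial z}P_{2n+1}(x,z)+(1+z+n(1+x))P_{2n+1}(x,z).$$
   Context: $\mathcal{S}_n$ denotes the set of permutations $\sigma=\sigma_1\cdots\sigma_n$ of $\{1,\dots,n\}$. $\overrightarrow{des}_E(\sigma)$ is the number of indices $i\in\{1,\dots,n-1\}$ with $\sigma_i>\sigma_{i+1}$ and $\sigma_{i+1}$ even. $\chi(\sigma_1\text{ even})$ is $1$ if $\sigma_1$ is even and $0$ otherwise. -}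

module Defs where

open import Data.Nat as ℕ using (ℕ; zero; suc; _<ᵇ_; _∸_)
open import Data.Bool using (Bool; true; false; not; _∧_; if_then_else_)
open import Data.List using (List; []; _∷_; map; concatMap; filter; length; upTo)
open import Data.Integer as ℤ using (ℤ; +_; _+_; _*_; _-_)
open import Data.Nat.Properties using (_≟_)
open import Data.List.Relation.Unary.Unique.DecPropositional _≟_ using (unique?)
open import Relation.Binary.PropositionalEquality using (_≡_)

words : ℕ → List ℕ → List (List ℕ)
words zero    A = [] ∷ []
words (suc k) A = concatMap (λ a → map (a ∷_) (words k A)) A

oneTo : ℕ → List ℕ
oneTo n = map suc (upTo n)

𝒮 : ℕ → List (List ℕ)
𝒮 n = filter unique? (words n (oneTo n))

isEven : ℕ → Bool
isEven zero          = true
isEven (suc zero)    = false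
isEven (suc (suc n)) = isEven n

desE : List ℕ → ℕ
desE []            = zero
desE (a ∷ [])      = zero
desE (a ∷ b ∷ σ)   = (if (b <ᵇ a) ∧ isEven b then 1 else 0) ℕ.+ desE (b ∷ σ)

χfirstEven : List ℕ → ℕ
χfirstEven []      = 0
χfirstEven (a ∷ _) = if isEven a then 1 else 0

-- Bivariate formal power series / polynomials in x, z with integer
-- coefficients, represented by their coefficient function:
-- f i j = coefficient of xⁱ zʲ.

Poly : Set
Poly = ℕ → ℕ → ℤ

infix 4 _≈_
_≈_ : Poly → Poly → Set
f ≈ g = ∀ i j → f i j ≡ g i j

infixl 6 _⊕_ _⊖_
infixl 7 _⊛_

_⊕_ : Poly → Poly → Poly
(f ⊕ g) i j = f i j + g i j

_⊖_ : Poly → Poly → Poly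
(f ⊖ g) i j = f i j - g i j

Σ≤ : ℕ → (ℕ → ℤ) → ℤ
Σ≤ zero    h = h 0
Σ≤ (suc k) h = Σ≤ k h + h (suc k)

_⊛_ : Poly → Poly → Poly
(f ⊛ g) i j = Σ≤ i (λ a → Σ≤ j (λ b → f a b * g (i ∸ a) (j ∸ b)))

const : ℤ → Poly
const c zero zero = c
const c _    _    = + 0

𝟙 : Poly
𝟙 = const (+ 1)

X : Poly
X (suc zero) zero = + 1
X _          _    = + 0

Z : Poly
Z zero (suc zero) = + 1
Z _    _          = + 0

∂x : Poly → Poly
∂x f i j = + (suc i) * f (suc i) j

∂z : Poly → Poly
∂z f i j = + (suc j) * f i (suc j)

open import Relation.Nullary.Decidable using (_×-dec_)

P : ℕ → Poly
P n i j = + length (filter (λ σ → (desE σ ≟ i) ×-dec (χfirstEven σ ≟ j)) (𝒮 n))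

-- Every permutation of {1,…,m+1} arises exactly once by inserting m+1 into a permutation σ of
-- {1,…,m}. Inserting it in front creates a descent into σ₁ iff σ₁ is even and makes m+1 the first
-- letter; inserting it right after σᵢ raises desE by one iff σᵢ < σᵢ₊₁ with σᵢ₊₁ even, and changes
-- nothing otherwise. Every even letter of σ other than σ₁ is either such an ascent top or a descent
-- bottom, so desE σ + #(ascents into even letters) + χ(σ₁ even) = ⌊m/2⌋, which is the n of the
-- recurrence. Hence the insertions into σ contribute exactly the right-hand operator applied to the
-- monomial x^desE(σ) z^χ(σ₁ even), and the recurrences follow by linearity.

module Submission where

open import Defs
open import Function using (_∘_)
open import Data.Bool using (Bool; true; false; T; not; _∧_; if_then_else_)
import Data.Bool.Properties as Bool
open import Data.Nat as ℕ using (ℕ; zero; suc; _≤_; _∸_; z≤n; s≤s; _≡ᵇ_; _<ᵇ_; ⌊_/2⌋)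
import Data.Nat.Properties as ℕ
open import Data.List using (List; []; _∷_; map; concatMap; _++_)
open import Data.List.Membership.Propositional using (_∈_)
open import Data.List.Relation.Unary.Any using (here; there)
open import Data.List.Relation.Binary.Permutation.Propositional using (_↭_; refl; prep; swap; trans)
open import Data.Product using (_×_; _,_; proj₁; proj₂)
open import Data.Sum using (_⊎_; inj₁; inj₂)
open import Data.Empty using (⊥-elim)
open import Relation.Nullary using (¬_; yes; no)
open import Relation.Binary.PropositionalEquality as ≡ using (_≡_; _≢_; refl; cong; cong₂)

bit : Bool → ℕ
bit b = if b then 1 else 0

module Polynomials where
  open import Data.Integer using (ℤ; +_; _+_; _-_; _*_)
  import Data.Integer.Properties as ℤ
  open import Data.Integer.Tactic.RingSolver using (solve-∀)
  open import Algebra.Bundles using (AbelianGroup)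
  open import Algebra.Properties.Group (AbelianGroup.group ℤ.+-0-abelianGroup) using (∙-cancelʳ)
  open import Level using (0ℓ)
  open import Relation.Binary.Bundles using (Setoid)
  import Relation.Binary.Reasoning.Setoid as SetoidReasoning

  0̂ : Poly
  0̂ _ _ = + 0

  infixr 7 _⋆_
  _⋆_ : ℤ → Poly → Poly
  (c ⋆ f) i j = c * f i j

  ≈-setoid : Setoid 0ℓ 0ℓ
  ≈-setoid = record
    { Carrier       = Poly
    ; _≈_           = _≈_
    ; isEquivalence = record
      { refl  = λ _ _ → refl
      ; sym   = λ f≈g i j → ≡.sym (f≈g i j)
      ; trans = λ f≈g g≈h i j → ≡.trans (f≈g i j) (g≈h i j)
      }
    }

  open Setoid ≈-setoid public using ()
    renaming (refl to ≈-refl; sym to ≈-sym; trans to ≈-trans; reflexive to ≡⇒≈)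
  module ≈-Reasoning = SetoidReasoning ≈-setoid

  ⊕-cong : ∀ {f f′ g g′} → f ≈ f′ → g ≈ g′ → f ⊕ g ≈ f′ ⊕ g′
  ⊕-cong f≈f′ g≈g′ i j = cong₂ _+_ (f≈f′ i j) (g≈g′ i j)

  ⊕-congˡ : ∀ f {g g′} → g ≈ g′ → f ⊕ g ≈ f ⊕ g′
  ⊕-congˡ f g≈g′ i j = cong (λ s → f i j + s) (g≈g′ i j)

  ⊕-congʳ : ∀ {f f′} g → f ≈ f′ → f ⊕ g ≈ f′ ⊕ g
  ⊕-congʳ g f≈f′ i j = cong (λ s → s + g i j) (f≈f′ i j)

  ⊖-cong : ∀ {f f′ g g′} → f ≈ f′ → g ≈ g′ → f ⊖ g ≈ f′ ⊖ g′
  ⊖-cong f≈f′ g≈g′ i j = cong₂ _-_ (f≈f′ i j) (g≈g′ i j)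

  ⋆-cong : ∀ c {f g} → f ≈ g → c ⋆ f ≈ c ⋆ g
  ⋆-cong c f≈g i j = cong (c *_) (f≈g i j)

  ⊕-cancelʳ : ∀ {f g} h → f ⊕ h ≈ g ⊕ h → f ≈ g
  ⊕-cancelʳ h eq i j = ∙-cancelʳ (h i j) _ _ (eq i j)

  Σ≤-cong : ∀ k {g h : ℕ → ℤ} → (∀ a → a ≤ k → g a ≡ h a) → Σ≤ k g ≡ Σ≤ k h
  Σ≤-cong zero    g≡h = g≡h 0 z≤n
  Σ≤-cong (suc k) g≡h = cong₂ _+_ (Σ≤-cong k (λ a a≤k → g≡h a (ℕ.m≤n⇒m≤1+n a≤k))) (g≡h (suc k) ℕ.≤-refl)

  Σ≤-zero : ∀ k {h : ℕ → ℤ} → (∀ a → a ≤ k → h a ≡ + 0) → Σ≤ k h ≡ + 0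
  Σ≤-zero zero    h≡0 = h≡0 0 z≤n
  Σ≤-zero (suc k) h≡0 = cong₂ _+_ (Σ≤-zero k (λ a a≤k → h≡0 a (ℕ.m≤n⇒m≤1+n a≤k))) (h≡0 (suc k) ℕ.≤-refl)

  Σ≤-single : ∀ k a {h : ℕ → ℤ} → a ≤ k → (∀ b → b ≤ k → b ≢ a → h b ≡ + 0) → Σ≤ k h ≡ h a
  Σ≤-single zero    zero    _   _   = refl
  Σ≤-single (suc k) a {h} a≤1+k h≡0 with ℕ.m≤n⇒m<n∨m≡n a≤1+k
  ... | inj₁ (s≤s a≤k) = ≡.trans (cong₂ _+_ (Σ≤-single k a a≤k (λ b b≤k → h≡0 b (ℕ.m≤n⇒m≤1+n b≤k)))
                                            (h≡0 (suc k) ℕ.≤-refl (ℕ.>⇒≢ (s≤s a≤k))))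
                                  (ℤ.+-identityʳ (h a))
  ... | inj₂ refl      = ≡.trans (cong (_+ h (suc k))
                                       (Σ≤-zero k (λ b b≤k → h≡0 b (ℕ.m≤n⇒m≤1+n b≤k) (ℕ.<⇒≢ (s≤s b≤k)))))
                                  (ℤ.+-identityˡ (h (suc k)))

  Σ≤-distrib-+ : ∀ k (g h : ℕ → ℤ) → Σ≤ k (λ a → g a + h a) ≡ Σ≤ k g + Σ≤ k h
  Σ≤-distrib-+ zero    g h = refl
  Σ≤-distrib-+ (suc k) g h = ≡.trans (cong (_+ (g (suc k) + h (suc k))) (Σ≤-distrib-+ k g h))
                                     (interchange (Σ≤ k g) (Σ≤ k h) (g (suc k)) (h (suc k)))
    where
    interchange : ∀ a b c d → (a + b) + (c + d) ≡ (a + c) + (b + d)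
    interchange = solve-∀

  Σ≤-distrib-- : ∀ k (g h : ℕ → ℤ) → Σ≤ k (λ a → g a - h a) ≡ Σ≤ k g - Σ≤ k h
  Σ≤-distrib-- zero    g h = refl
  Σ≤-distrib-- (suc k) g h = ≡.trans (cong (_+ (g (suc k) - h (suc k))) (Σ≤-distrib-- k g h))
                                     (interchange (Σ≤ k g) (Σ≤ k h) (g (suc k)) (h (suc k)))
    where
    interchange : ∀ a b c d → (a - b) + (c - d) ≡ (a + c) - (b + d)
    interchange = solve-∀

  Σ≤-distribˡ-* : ∀ k c (h : ℕ → ℤ) → Σ≤ k (λ a → c * h a) ≡ c * Σ≤ k h
  Σ≤-distribˡ-* zero    c h = refl
  Σ≤-distribˡ-* (suc k) c h = ≡.trans (cong (_+ c * h (suc k)) (Σ≤-distribˡ-* k c h))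
                                      (≡.sym (ℤ.*-distribˡ-+ c (Σ≤ k h) (h (suc k))))

  mulX : Poly → Poly
  mulX f zero    j = + 0
  mulX f (suc i) j = f i j

  mulZ : Poly → Poly
  mulZ f i zero    = + 0
  mulZ f i (suc j) = f i j

  mulX-cong : ∀ {f g} → f ≈ g → mulX f ≈ mulX g
  mulX-cong f≈g zero    j = refl
  mulX-cong f≈g (suc i) j = f≈g i j

  mulZ-cong : ∀ {f g} → f ≈ g → mulZ f ≈ mulZ g
  mulZ-cong f≈g i zero    = refl
  mulZ-cong f≈g i (suc j) = f≈g i j

  mulX-⊕ : ∀ f g → mulX (f ⊕ g) ≈ mulX f ⊕ mulX g
  mulX-⊕ f g zero    j = refl
  mulX-⊕ f g (suc i) j = refl

  mulZ-⊕ : ∀ f g → mulZ (f ⊕ g) ≈ mulZ f ⊕ mulZ g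
  mulZ-⊕ f g i zero    = refl
  mulZ-⊕ f g i (suc j) = refl

  mulX-⊖ : ∀ f g → mulX (f ⊖ g) ≈ mulX f ⊖ mulX g
  mulX-⊖ f g zero    j = refl
  mulX-⊖ f g (suc i) j = refl

  mulZ-⊖ : ∀ f g → mulZ (f ⊖ g) ≈ mulZ f ⊖ mulZ g
  mulZ-⊖ f g i zero    = refl
  mulZ-⊖ f g i (suc j) = refl

  mulX-0̂ : mulX 0̂ ≈ 0̂
  mulX-0̂ zero    j = refl
  mulX-0̂ (suc i) j = refl

  mulZ-0̂ : mulZ 0̂ ≈ 0̂
  mulZ-0̂ i zero    = refl
  mulZ-0̂ i (suc j) = refl

  mulX-⋆ : ∀ c f → mulX (c ⋆ f) ≈ c ⋆ mulX f
  mulX-⋆ c f zero    j = ≡.sym (ℤ.*-zeroʳ c)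
  mulX-⋆ c f (suc i) j = refl

  mulZ-⋆ : ∀ c f → mulZ (c ⋆ f) ≈ c ⋆ mulZ f
  mulZ-⋆ c f i zero    = ≡.sym (ℤ.*-zeroʳ c)
  mulZ-⋆ c f i (suc j) = refl

  shift : ℕ → ℕ → Poly → Poly
  shift zero    zero    f = f
  shift zero    (suc b) f = mulZ (shift zero b f)
  shift (suc a) b       f = mulX (shift a b f)

  shift-inside : ∀ a b g {i j} → a ≤ i → b ≤ j → shift a b g i j ≡ g (i ∸ a) (j ∸ b)
  shift-inside zero    zero    g         _       _       = refl
  shift-inside zero    (suc b) g {j = suc j} a≤i (s≤s b≤j) = shift-inside zero b g a≤i b≤j
  shift-inside (suc a) b       g {suc i}   (s≤s a≤i) b≤j = shift-inside a b g a≤i b≤j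

  shift-outside : ∀ a b g {i j} → ¬ a ≤ i ⊎ ¬ b ≤ j → shift a b g i j ≡ + 0
  shift-outside zero    zero    g (inj₁ 0≰i) = ⊥-elim (0≰i z≤n)
  shift-outside zero    zero    g (inj₂ 0≰j) = ⊥-elim (0≰j z≤n)
  shift-outside zero    (suc b) g {j = zero}  _ = refl
  shift-outside zero    (suc b) g {j = suc j} (inj₁ 0≰i) = shift-outside zero b g (inj₁ 0≰i)
  shift-outside zero    (suc b) g {j = suc j} (inj₂ b≰j) = shift-outside zero b g (inj₂ (b≰j ∘ s≤s))
  shift-outside (suc a) b       g {zero}    _ = refl
  shift-outside (suc a) b       g {suc i}   (inj₁ a≰i) = shift-outside a b g (inj₁ (a≰i ∘ s≤s))
  shift-outside (suc a) b       g {suc i}   (inj₂ b≰j) = shift-outside a b g (inj₂ b≰j)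

  ⊛-congˡ : ∀ {f f′} g → f ≈ f′ → f ⊛ g ≈ f′ ⊛ g
  ⊛-congˡ g f≈f′ i j = Σ≤-cong i (λ a _ → Σ≤-cong j (λ b _ → cong (_* g (i ∸ a) (j ∸ b)) (f≈f′ a b)))

  ⊛-distribʳ-⊕ : ∀ f f′ g → (f ⊕ f′) ⊛ g ≈ f ⊛ g ⊕ f′ ⊛ g
  ⊛-distribʳ-⊕ f f′ g i j = ≡.trans
    (Σ≤-cong i (λ a _ → ≡.trans (Σ≤-cong j (λ b _ → ℤ.*-distribʳ-+ (g (i ∸ a) (j ∸ b)) (f a b) (f′ a b)))
                                (Σ≤-distrib-+ j _ _)))
    (Σ≤-distrib-+ i _ _)

  ⊛-distribʳ-⊖ : ∀ f f′ g → (f ⊖ f′) ⊛ g ≈ f ⊛ g ⊖ f′ ⊛ g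
  ⊛-distribʳ-⊖ f f′ g i j = ≡.trans
    (Σ≤-cong i (λ a _ → ≡.trans (Σ≤-cong j (λ b _ → distrib (f a b) (f′ a b) (g (i ∸ a) (j ∸ b))))
                                (Σ≤-distrib-- j _ _)))
    (Σ≤-distrib-- i _ _)
    where
    distrib : ∀ x y z → (x - y) * z ≡ x * z - y * z
    distrib = solve-∀

  ⋆-⊛ : ∀ c f g → (c ⋆ f) ⊛ g ≈ c ⋆ (f ⊛ g)
  ⋆-⊛ c f g i j = ≡.trans
    (Σ≤-cong i (λ a _ → ≡.trans (Σ≤-cong j (λ b _ → ℤ.*-assoc c (f a b) (g (i ∸ a) (j ∸ b))))
                                (Σ≤-distribˡ-* j c _)))
    (Σ≤-distribˡ-* i c _)

  SupportedAt : ℕ → ℕ → Poly → Set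
  SupportedAt a b f = ∀ a′ b′ → (a′ , b′) ≢ (a , b) → f a′ b′ ≡ + 0

  module _ {a b f} (supp : SupportedAt a b f) (g : Poly) where

    private
      vanish : ∀ {a′ b′ k l} → (a′ , b′) ≢ (a , b) → f a′ b′ * g k l ≡ + 0
      vanish off = cong (_* _) (supp _ _ off)

      vanishing-product : ∀ {i j} → ¬ a ≤ i ⊎ ¬ b ≤ j →
                          (∀ {a′ b′} → a′ ≤ i → b′ ≤ j → (a′ , b′) ≢ (a , b)) →
                          (f ⊛ g) i j ≡ f a b * shift a b g i j
      vanishing-product {i} {j} out off = ≡.trans
        (Σ≤-zero i (λ a′ a′≤i → Σ≤-zero j (λ b′ b′≤j → vanish (off a′≤i b′≤j))))
        (≡.sym (≡.trans (cong (f a b *_) (shift-outside a b g out)) (ℤ.*-zeroʳ (f a b))))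

    ⊛-supportedAt : ∀ i j → (f ⊛ g) i j ≡ f a b * shift a b g i j
    ⊛-supportedAt i j with a ℕ.≤? i | b ℕ.≤? j
    ... | yes a≤i | yes b≤j = begin
      (f ⊛ g) i j                               ≡⟨ Σ≤-single i a a≤i (λ a′ _ a′≢a →
                                                     Σ≤-zero j (λ _ _ → vanish (a′≢a ∘ cong proj₁))) ⟩
      Σ≤ j (λ b′ → f a b′ * g (i ∸ a) (j ∸ b′)) ≡⟨ Σ≤-single j b b≤j (λ _ _ b′≢b →
                                                     vanish (b′≢b ∘ cong proj₂)) ⟩
      f a b * g (i ∸ a) (j ∸ b)                 ≡⟨ cong (f a b *_) (shift-inside a b g a≤i b≤j) ⟨
      f a b * shift a b g i j                   ∎
      where open ≡.≡-Reasoning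
    ... | no a≰i | _      =
      vanishing-product (inj₁ a≰i) (λ a′≤i _ eq → a≰i (≡.subst (_≤ i) (cong proj₁ eq) a′≤i))
    ... | yes _  | no b≰j =
      vanishing-product (inj₂ b≰j) (λ _ b′≤j eq → b≰j (≡.subst (_≤ j) (cong proj₂ eq) b′≤j))

  ⊛-shift : ∀ {a b f} → SupportedAt a b f → f a b ≡ + 1 → ∀ g → f ⊛ g ≈ shift a b g
  ⊛-shift supp f₁ g i j = ≡.trans (⊛-supportedAt supp g i j) (≡.trans (cong (_* _) f₁) (ℤ.*-identityˡ _))

  const-supportedAt : ∀ c → SupportedAt 0 0 (const c)
  const-supportedAt c zero    zero    off = ⊥-elim (off refl)
  const-supportedAt c zero    (suc b) _   = refl
  const-supportedAt c (suc a) b       _   = refl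

  𝟙-supportedAt : SupportedAt 0 0 𝟙
  𝟙-supportedAt = const-supportedAt (+ 1)

  X-supportedAt : SupportedAt 1 0 X
  X-supportedAt zero          b       _   = refl
  X-supportedAt (suc zero)    zero    off = ⊥-elim (off refl)
  X-supportedAt (suc zero)    (suc b) _   = refl
  X-supportedAt (suc (suc a)) b       _   = refl

  Z-supportedAt : SupportedAt 0 1 Z
  Z-supportedAt zero    zero          _   = refl
  Z-supportedAt zero    (suc zero)    off = ⊥-elim (off refl)
  Z-supportedAt zero    (suc (suc b)) _   = refl
  Z-supportedAt (suc a) b             _   = refl

  mulX-supportedAt : ∀ {a b f} → SupportedAt a b f → SupportedAt (suc a) b (mulX f)
  mulX-supportedAt supp zero     b′ _   = refl
  mulX-supportedAt supp (suc a′) b′ off = supp a′ b′ (λ { refl → off refl })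

  mulZ-supportedAt : ∀ {a b f} → SupportedAt a b f → SupportedAt a (suc b) (mulZ f)
  mulZ-supportedAt supp a′ zero     _   = refl
  mulZ-supportedAt supp a′ (suc b′) off = supp a′ b′ (λ { refl → off refl })

  -- The right-hand sides of the recurrences, without products

  x[1-x]∂x : Poly → Poly
  x[1-x]∂x f = mulX (∂x f) ⊖ mulX (mulX (∂x f))

  x[1-z]∂z : Poly → Poly
  x[1-z]∂z f = mulX (∂z f) ⊖ mulX (mulZ (∂z f))

  z[1-z]∂z : Poly → Poly
  z[1-z]∂z f = mulZ (∂z f) ⊖ mulZ (mulZ (∂z f))

  oddRecurrence : ℕ → Poly → Poly
  oddRecurrence n f = x[1-x]∂x f ⊕ x[1-z]∂z f ⊕ (f ⊕ + n ⋆ (f ⊕ mulX f))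

  evenRecurrence : ℕ → Poly → Poly
  evenRecurrence n f = x[1-x]∂x f ⊕ z[1-z]∂z f ⊕ (f ⊕ mulZ f ⊕ + n ⋆ (f ⊕ mulX f))

  𝟙⊛ : ∀ g → 𝟙 ⊛ g ≈ g
  𝟙⊛ = ⊛-shift 𝟙-supportedAt refl

  X⊛ : ∀ g → X ⊛ g ≈ mulX g
  X⊛ = ⊛-shift X-supportedAt refl

  Z⊛ : ∀ g → Z ⊛ g ≈ mulZ g
  Z⊛ = ⊛-shift Z-supportedAt refl

  const⊛ : ∀ c g → const c ⊛ g ≈ c ⋆ g
  const⊛ c = ⊛-supportedAt (const-supportedAt c)

  ⊖⊛-shifts : ∀ {a b c d f g} → SupportedAt a b f → f a b ≡ + 1 → SupportedAt c d g → g c d ≡ + 1 →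
              ∀ h → (f ⊖ g) ⊛ h ≈ shift a b h ⊖ shift c d h
  ⊖⊛-shifts {f = f} {g} suppf f₁ suppg g₁ h =
    ≈-trans (⊛-distribʳ-⊖ f g h) (⊖-cong (⊛-shift suppf f₁ h) (⊛-shift suppg g₁ h))

  X⊛[𝟙⊖X]⊛ : ∀ g → X ⊛ (𝟙 ⊖ X) ⊛ g ≈ mulX g ⊖ mulX (mulX g)
  X⊛[𝟙⊖X]⊛ g = ≈-trans (⊛-congˡ g (≈-trans (X⊛ (𝟙 ⊖ X)) (mulX-⊖ 𝟙 X)))
                       (⊖⊛-shifts (mulX-supportedAt 𝟙-supportedAt) refl (mulX-supportedAt X-supportedAt) refl g)

  X⊛[𝟙⊖Z]⊛ : ∀ g → X ⊛ (𝟙 ⊖ Z) ⊛ g ≈ mulX g ⊖ mulX (mulZ g)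
  X⊛[𝟙⊖Z]⊛ g = ≈-trans (⊛-congˡ g (≈-trans (X⊛ (𝟙 ⊖ Z)) (mulX-⊖ 𝟙 Z)))
                       (⊖⊛-shifts (mulX-supportedAt 𝟙-supportedAt) refl (mulX-supportedAt Z-supportedAt) refl g)

  Z⊛[𝟙⊖Z]⊛ : ∀ g → Z ⊛ (𝟙 ⊖ Z) ⊛ g ≈ mulZ g ⊖ mulZ (mulZ g)
  Z⊛[𝟙⊖Z]⊛ g = ≈-trans (⊛-congˡ g (≈-trans (Z⊛ (𝟙 ⊖ Z)) (mulZ-⊖ 𝟙 Z)))
                       (⊖⊛-shifts (mulZ-supportedAt 𝟙-supportedAt) refl (mulZ-supportedAt Z-supportedAt) refl g)

  const⊛[𝟙⊕X]⊛ : ∀ c g → const c ⊛ (𝟙 ⊕ X) ⊛ g ≈ c ⋆ (g ⊕ mulX g)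
  const⊛[𝟙⊕X]⊛ c g = begin
    const c ⊛ (𝟙 ⊕ X) ⊛ g    ≈⟨ ⊛-congˡ g (const⊛ c (𝟙 ⊕ X)) ⟩
    (c ⋆ (𝟙 ⊕ X)) ⊛ g        ≈⟨ ⋆-⊛ c (𝟙 ⊕ X) g ⟩
    c ⋆ ((𝟙 ⊕ X) ⊛ g)        ≈⟨ ⋆-cong c (≈-trans (⊛-distribʳ-⊕ 𝟙 X g) (⊕-cong (𝟙⊛ g) (X⊛ g))) ⟩
    c ⋆ (g ⊕ mulX g)         ∎
    where open ≈-Reasoning

  oddRecurrence-⊛ : ∀ n f →
    X ⊛ (𝟙 ⊖ X) ⊛ ∂x f ⊕ X ⊛ (𝟙 ⊖ Z) ⊛ ∂z f ⊕ (𝟙 ⊕ const (+ n) ⊛ (𝟙 ⊕ X)) ⊛ f ≈ oddRecurrence n f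
  oddRecurrence-⊛ n f =
    ⊕-cong (⊕-cong (X⊛[𝟙⊖X]⊛ (∂x f)) (X⊛[𝟙⊖Z]⊛ (∂z f)))
           (≈-trans (⊛-distribʳ-⊕ 𝟙 _ f) (⊕-cong (𝟙⊛ f) (const⊛[𝟙⊕X]⊛ (+ n) f)))

  evenRecurrence-⊛ : ∀ n f →
    X ⊛ (𝟙 ⊖ X) ⊛ ∂x f ⊕ Z ⊛ (𝟙 ⊖ Z) ⊛ ∂z f ⊕ (𝟙 ⊕ Z ⊕ const (+ n) ⊛ (𝟙 ⊕ X)) ⊛ f ≈ evenRecurrence n f
  evenRecurrence-⊛ n f =
    ⊕-cong (⊕-cong (X⊛[𝟙⊖X]⊛ (∂x f)) (Z⊛[𝟙⊖Z]⊛ (∂z f)))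
           (≈-trans (⊛-distribʳ-⊕ (𝟙 ⊕ Z) _ f)
                    (⊕-cong (≈-trans (⊛-distribʳ-⊕ 𝟙 Z f) (⊕-cong (𝟙⊛ f) (Z⊛ f)))
                            (const⊛[𝟙⊕X]⊛ (+ n) f)))

  record Additive (T : Poly → Poly) : Set where
    field
      ≈-cong : ∀ {f g} → f ≈ g → T f ≈ T g
      ⊕-homo : ∀ f g → T (f ⊕ g) ≈ T f ⊕ T g
      0̂-homo : T 0̂ ≈ 0̂

  open Additive public

  mulX-additive : Additive mulX
  mulX-additive = record { ≈-cong = mulX-cong ; ⊕-homo = mulX-⊕ ; 0̂-homo = mulX-0̂ }

  mulZ-additive : Additive mulZ
  mulZ-additive = record { ≈-cong = mulZ-cong ; ⊕-homo = mulZ-⊕ ; 0̂-homo = mulZ-0̂ }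

  ∂x-additive : Additive ∂x
  ∂x-additive = record
    { ≈-cong = λ f≈g i j → ≡.cong (+ suc i *_) (f≈g (suc i) j)
    ; ⊕-homo = λ f g i j → ℤ.*-distribˡ-+ (+ suc i) (f (suc i) j) (g (suc i) j)
    ; 0̂-homo = λ i j → ℤ.*-zeroʳ (+ suc i)
    }

  ∂z-additive : Additive ∂z
  ∂z-additive = record
    { ≈-cong = λ f≈g i j → ≡.cong (+ suc j *_) (f≈g i (suc j))
    ; ⊕-homo = λ f g i j → ℤ.*-distribˡ-+ (+ suc j) (f i (suc j)) (g i (suc j))
    ; 0̂-homo = λ i j → ℤ.*-zeroʳ (+ suc j)
    }

  ⋆-additive : ∀ c → Additive (c ⋆_)
  ⋆-additive c = record
    { ≈-cong = ⋆-cong c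
    ; ⊕-homo = λ f g i j → ℤ.*-distribˡ-+ c (f i j) (g i j)
    ; 0̂-homo = λ i j → ℤ.*-zeroʳ c
    }

  id-additive : Additive (λ f → f)
  id-additive = record { ≈-cong = λ f≈g → f≈g ; ⊕-homo = λ _ _ → ≈-refl ; 0̂-homo = ≈-refl }

  ∘-additive : ∀ {S T} → Additive S → Additive T → Additive (S ∘ T)
  ∘-additive addS addT = record
    { ≈-cong = ≈-cong addS ∘ ≈-cong addT
    ; ⊕-homo = λ f g → ≈-trans (≈-cong addS (⊕-homo addT f g)) (⊕-homo addS _ _)
    ; 0̂-homo = ≈-trans (≈-cong addS (0̂-homo addT)) (0̂-homo addS)
    }

  ⊕-additive : ∀ {S T} → Additive S → Additive T → Additive (λ f → S f ⊕ T f)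
  ⊕-additive {S} {T} addS addT = record
    { ≈-cong = λ f≈g → ⊕-cong (≈-cong addS f≈g) (≈-cong addT f≈g)
    ; ⊕-homo = λ f g i j → ≡.trans (cong₂ _+_ (⊕-homo addS f g i j) (⊕-homo addT f g i j))
                                   (interchange (S f i j) (S g i j) (T f i j) (T g i j))
    ; 0̂-homo = ⊕-cong (0̂-homo addS) (0̂-homo addT)
    }
    where
    interchange : ∀ a b c d → (a + b) + (c + d) ≡ (a + c) + (b + d)
    interchange = solve-∀

  ⊖-additive : ∀ {S T} → Additive S → Additive T → Additive (λ f → S f ⊖ T f)
  ⊖-additive {S} {T} addS addT = record
    { ≈-cong = λ f≈g → ⊖-cong (≈-cong addS f≈g) (≈-cong addT f≈g)
    ; ⊕-homo = λ f g i j → ≡.trans (cong₂ _-_ (⊕-homo addS f g i j) (⊕-homo addT f g i j))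
                                   (interchange (S f i j) (S g i j) (T f i j) (T g i j))
    ; 0̂-homo = ⊖-cong (0̂-homo addS) (0̂-homo addT)
    }
    where
    interchange : ∀ a b c d → (a + b) - (c + d) ≡ (a - c) + (b - d)
    interchange = solve-∀

  oddRecurrence-additive : ∀ n → Additive (oddRecurrence n)
  oddRecurrence-additive n =
    ⊕-additive (⊕-additive (⊖-additive (∘-additive mulX-additive ∂x-additive)
                                      (∘-additive mulX-additive (∘-additive mulX-additive ∂x-additive)))
                          (⊖-additive (∘-additive mulX-additive ∂z-additive)
                                      (∘-additive mulX-additive (∘-additive mulZ-additive ∂z-additive))))
               (⊕-additive id-additive (∘-additive (⋆-additive (+ n)) (⊕-additive id-additive mulX-additive)))

  evenRecurrence-additive : ∀ n → Additive (evenRecurrence n)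
  evenRecurrence-additive n =
    ⊕-additive (⊕-additive (⊖-additive (∘-additive mulX-additive ∂x-additive)
                                      (∘-additive mulX-additive (∘-additive mulX-additive ∂x-additive)))
                          (⊖-additive (∘-additive mulZ-additive ∂z-additive)
                                      (∘-additive mulZ-additive (∘-additive mulZ-additive ∂z-additive))))
               (⊕-additive (⊕-additive id-additive mulZ-additive)
                           (∘-additive (⋆-additive (+ n)) (⊕-additive id-additive mulX-additive)))

  ∑ : {A : Set} → List A → (A → Poly) → Poly
  ∑ []       h = 0̂
  ∑ (x ∷ xs) h = h x ⊕ ∑ xs h

  ∑-cong : ∀ {A : Set} (xs : List A) {g h} → (∀ {x} → x ∈ xs → g x ≈ h x) → ∑ xs g ≈ ∑ xs h
  ∑-cong []       g≈h = ≈-refl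
  ∑-cong (x ∷ xs) g≈h = ⊕-cong (g≈h (here refl)) (∑-cong xs (g≈h ∘ there))

  ∑-↭ : ∀ {A : Set} {xs ys : List A} (h : A → Poly) → xs ↭ ys → ∑ xs h ≈ ∑ ys h
  ∑-↭ h refl         = ≈-refl
  ∑-↭ h (prep x p)   = ⊕-congˡ (h x) (∑-↭ h p)
  ∑-↭ h (swap x y p) i j = ≡.trans (cong (λ s → h x i j + (h y i j + s)) (∑-↭ h p i j))
                                   (exchange (h x i j) (h y i j) _)
    where
    exchange : ∀ a b c → a + (b + c) ≡ b + (a + c)
    exchange = solve-∀
  ∑-↭ h (trans p q)  = ≈-trans (∑-↭ h p) (∑-↭ h q)

  ∑-++ : ∀ {A : Set} (xs ys : List A) h → ∑ (xs ++ ys) h ≈ ∑ xs h ⊕ ∑ ys h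
  ∑-++ []       ys h i j = ≡.sym (ℤ.+-identityˡ _)
  ∑-++ (x ∷ xs) ys h i j = ≡.trans (cong (λ s → h x i j + s) (∑-++ xs ys h i j))
                                   (≡.sym (ℤ.+-assoc (h x i j) (∑ xs h i j) (∑ ys h i j)))

  ∑-concatMap : ∀ {A B : Set} (g : A → List B) (xs : List A) h →
                ∑ (concatMap g xs) h ≈ ∑ xs (λ x → ∑ (g x) h)
  ∑-concatMap g []       h = ≈-refl
  ∑-concatMap g (x ∷ xs) h =
    ≈-trans (∑-++ (g x) (concatMap g xs) h) (⊕-congˡ (∑ (g x) h) (∑-concatMap g xs h))

  ∑-map : ∀ {A B : Set} (g : A → B) (xs : List A) h → ∑ (map g xs) h ≈ ∑ xs (h ∘ g)
  ∑-map g []       h = ≈-refl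
  ∑-map g (x ∷ xs) h = ⊕-congˡ (h (g x)) (∑-map g xs h)

  ∑-homo : ∀ {T} → Additive T → ∀ {A : Set} (xs : List A) h → T (∑ xs h) ≈ ∑ xs (T ∘ h)
  ∑-homo addT []       h = 0̂-homo addT
  ∑-homo {T} addT (x ∷ xs) h =
    ≈-trans (⊕-homo addT (h x) (∑ xs h)) (⊕-congˡ (T (h x)) (∑-homo addT xs h))

  mono : ℕ → ℕ → Poly
  mono d e i j = if (d ≡ᵇ i) ∧ (e ≡ᵇ j) then + 1 else + 0

  mulX-mono : ∀ d e → mulX (mono d e) ≈ mono (suc d) e
  mulX-mono d e zero    j = refl
  mulX-mono d e (suc i) j = refl

  mulZ-mono : ∀ d e → mulZ (mono d e) ≈ mono d (suc e)
  mulZ-mono d e i zero    rewrite Bool.∧-zeroʳ (d ≡ᵇ i) = refl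
  mulZ-mono d e i (suc j) = refl

  x-degree-scales-mono : ∀ d e i j → + i * mono d e i j ≡ + d * mono d e i j
  x-degree-scales-mono d e i j with d ≡ᵇ i in d≡ᵇi
  ... | true  = cong (λ k → + k * _) (≡.sym (ℕ.≡ᵇ⇒≡ d i (≡.subst T (≡.sym d≡ᵇi) _)))
  ... | false = ≡.trans (ℤ.*-zeroʳ (+ i)) (≡.sym (ℤ.*-zeroʳ (+ d)))

  z-degree-scales-mono : ∀ d e i j → + j * mono d e i j ≡ + e * mono d e i j
  z-degree-scales-mono d e i j with e ≡ᵇ j in e≡ᵇj
  ... | true  = cong (λ k → + k * _) (≡.sym (ℕ.≡ᵇ⇒≡ e j (≡.subst T (≡.sym e≡ᵇj) _)))
  ... | false rewrite Bool.∧-zeroʳ (d ≡ᵇ i) = ≡.trans (ℤ.*-zeroʳ (+ j)) (≡.sym (ℤ.*-zeroʳ (+ e)))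

  x∂x-mono : ∀ d e → mulX (∂x (mono d e)) ≈ + d ⋆ mono d e
  x∂x-mono d e zero    j = x-degree-scales-mono d e 0 j
  x∂x-mono d e (suc i) j = x-degree-scales-mono d e (suc i) j

  z∂z-mono : ∀ d e → mulZ (∂z (mono d e)) ≈ + e ⋆ mono d e
  z∂z-mono d e i zero    = z-degree-scales-mono d e i 0
  z∂z-mono d e i (suc j) = z-degree-scales-mono d e i (suc j)

  ∂z-mono-zero : ∀ d → ∂z (mono d 0) ≈ 0̂
  ∂z-mono-zero d i j rewrite Bool.∧-zeroʳ (d ≡ᵇ i) = ℤ.*-zeroʳ (+ suc j)

  ∂z-mono-suc : ∀ d e → ∂z (mono d (suc e)) ≈ + suc e ⋆ mono d e
  ∂z-mono-suc d e i j = z-degree-scales-mono d (suc e) i (suc j)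

  mulX-⋆-mono : ∀ c d e → mulX (c ⋆ mono d e) ≈ c ⋆ mono (suc d) e
  mulX-⋆-mono c d e = ≈-trans (mulX-⋆ c (mono d e)) (⋆-cong c (mulX-mono d e))

  x[1-x]∂x-mono : ∀ d e → x[1-x]∂x (mono d e) ≈ + d ⋆ mono d e ⊖ + d ⋆ mono (suc d) e
  x[1-x]∂x-mono d e = ⊖-cong (x∂x-mono d e) (begin
    mulX (mulX (∂x (mono d e))) ≈⟨ mulX-cong (x∂x-mono d e) ⟩
    mulX (+ d ⋆ mono d e)       ≈⟨ mulX-⋆-mono (+ d) d e ⟩
    + d ⋆ mono (suc d) e        ∎)
    where open ≈-Reasoning

  x[1-z]∂z-mono : ∀ d e → x[1-z]∂z (mono d e) ≈ mulX (∂z (mono d e)) ⊖ + e ⋆ mono (suc d) e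
  x[1-z]∂z-mono d e = ⊖-cong (≈-refl {x = mulX (∂z (mono d e))}) (begin
    mulX (mulZ (∂z (mono d e))) ≈⟨ mulX-cong (z∂z-mono d e) ⟩
    mulX (+ e ⋆ mono d e)       ≈⟨ mulX-⋆-mono (+ e) d e ⟩
    + e ⋆ mono (suc d) e        ∎)
    where open ≈-Reasoning

  z[1-z]∂z-mono : ∀ d e → z[1-z]∂z (mono d e) ≈ + e ⋆ mono d e ⊖ + e ⋆ mono d (suc e)
  z[1-z]∂z-mono d e = ⊖-cong (z∂z-mono d e) (begin
    mulZ (mulZ (∂z (mono d e))) ≈⟨ mulZ-cong (z∂z-mono d e) ⟩
    mulZ (+ e ⋆ mono d e)       ≈⟨ mulZ-⋆ (+ e) (mono d e) ⟩
    + e ⋆ mulZ (mono d e)       ≈⟨ ⋆-cong (+ e) (mulZ-mono d e) ⟩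
    + e ⋆ mono d (suc e)        ∎)
    where open ≈-Reasoning

  x∂z-mono-one : ∀ d → mulX (∂z (mono d 1)) ≈ + 1 ⋆ mono (suc d) 0
  x∂z-mono-one d = ≈-trans (mulX-cong (∂z-mono-suc d 0)) (mulX-⋆-mono (+ 1) d 0)

  x∂z-mono-zero : ∀ d → mulX (∂z (mono d 0)) ≈ 0̂
  x∂z-mono-zero d = ≈-trans (mulX-cong (∂z-mono-zero d)) mulX-0̂

  oddRecurrence-mono : ∀ n d e → let m = mono d e ; m⁺ = mono (suc d) e in
    oddRecurrence n m ≈ (+ d ⋆ m ⊖ + d ⋆ m⁺) ⊕ (mulX (∂z m) ⊖ + e ⋆ m⁺) ⊕ (m ⊕ + n ⋆ (m ⊕ m⁺))
  oddRecurrence-mono n d e =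
    ⊕-cong (⊕-cong (x[1-x]∂x-mono d e) (x[1-z]∂z-mono d e))
           (⊕-congˡ (mono d e) (⋆-cong (+ n) (⊕-congˡ (mono d e) (mulX-mono d e))))

  evenRecurrence-mono : ∀ n d e → let m = mono d e ; m⁺ = mono (suc d) e ; mᶻ = mono d (suc e) in
    evenRecurrence n m ≈ (+ d ⋆ m ⊖ + d ⋆ m⁺) ⊕ (+ e ⋆ m ⊖ + e ⋆ mᶻ) ⊕ (m ⊕ mᶻ ⊕ + n ⋆ (m ⊕ m⁺))
  evenRecurrence-mono n d e =
    ⊕-cong (⊕-cong (x[1-x]∂x-mono d e) (z[1-z]∂z-mono d e))
           (⊕-cong (⊕-congˡ (mono d e) (mulZ-mono d e)) (⋆-cong (+ n) (⊕-congˡ (mono d e) (mulX-mono d e))))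

module Permutations where
  open import Data.List using (upTo; length)
  import Data.List.Properties as Listₚ
  open import Data.List.Membership.Propositional using (_∉_; find)
  open import Data.List.Membership.Propositional.Properties
    using (∈-map⁺; ∈-map⁻; ∈-concatMap⁺; ∈-concatMap⁻; ∈-filter⁺; ∈-filter⁻; ∈-upTo⁺; ∈-upTo⁻; ∈-∃++)
  open import Data.List.Membership.Propositional.Properties.WithK using (unique∧set⇒bag)
  open import Data.List.Membership.DecPropositional ℕ._≟_ using (_∈?_)
  open import Data.List.Relation.Unary.All as All using (All; []; _∷_)
  import Data.List.Relation.Unary.All.Properties as Allₚ
  import Data.List.Relation.Unary.Any as Any
  open import Data.List.Relation.Unary.AllPairs as AllPairs using (AllPairs; []; _∷_)
  import Data.List.Relation.Unary.AllPairs.Properties as AllPairsₚ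
  open import Data.List.Relation.Unary.Unique.Propositional using (Unique)
  import Data.List.Relation.Unary.Unique.Propositional.Properties as Uniqueₚ
  open import Data.List.Relation.Unary.Unique.DecPropositional ℕ._≟_ using (unique?)
  open import Data.List.Relation.Binary.Disjoint.Propositional using (Disjoint)
  open import Data.List.Relation.Binary.Subset.Propositional using (_⊆_)
  open import Data.List.Relation.Binary.Permutation.Propositional using (↭-sym; ↭⇒↭ₛ)
  open import Data.List.Relation.Binary.Permutation.Propositional.Properties
    using (All-resp-↭; ∈-resp-↭; shift; ↭-length)
  open import Data.List.Relation.Binary.Permutation.Setoid.Properties (≡.setoid ℕ) using (Unique-resp-↭)
  open import Data.List.Relation.Binary.BagAndSetEquality using (∼bag⇒↭)
  open import Function.Bundles using (mk⇔)

  insertions : {A : Set} → A → List A → List (List A)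
  insertions x []      = (x ∷ []) ∷ []
  insertions x (a ∷ σ) = (x ∷ a ∷ σ) ∷ map (a ∷_) (insertions x σ)

  insertions-↭ : ∀ {A : Set} {x : A} σ {w} → w ∈ insertions x σ → w ↭ x ∷ σ
  insertions-↭ []      (here refl) = refl
  insertions-↭ (a ∷ σ) (here refl) = refl
  insertions-↭ (a ∷ σ) (there w∈) with ∈-map⁻ (a ∷_) w∈
  ... | w′ , w′∈ , refl = trans (prep a (insertions-↭ σ w′∈)) (swap a _ refl)

  ∈-insertions : ∀ {A : Set} {x : A} u v → u ++ x ∷ v ∈ insertions x (u ++ v)
  ∈-insertions []      []      = here refl
  ∈-insertions []      (a ∷ v) = here refl
  ∈-insertions (a ∷ u) v       = there (∈-map⁺ (a ∷_) (∈-insertions u v))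

  insertions-unique : ∀ {A : Set} {x : A} σ → x ∉ σ → Unique (insertions x σ)
  insertions-unique []      _   = [] ∷ []
  insertions-unique (a ∷ σ) x∉σ =
    Allₚ.map⁺ (All.tabulate (λ _ eq → x∉σ (here (Listₚ.∷-injectiveˡ eq))))
    ∷ Uniqueₚ.map⁺ Listₚ.∷-injectiveʳ (insertions-unique σ (x∉σ ∘ there))

  insertions-injective : ∀ {A : Set} {x : A} σ τ {w} → x ∉ σ → x ∉ τ →
                         w ∈ insertions x σ → w ∈ insertions x τ → σ ≡ τ
  insertions-injective []      []      _   _   _           _           = refl
  insertions-injective []      (b ∷ τ) _   x∉τ (here refl) (there q)   with ∈-map⁻ (b ∷_) q
  ... | _ , _ , eq = ⊥-elim (x∉τ (here (Listₚ.∷-injectiveˡ eq)))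
  insertions-injective (a ∷ σ) []      x∉σ _   (there p)   (here refl) with ∈-map⁻ (a ∷_) p
  ... | _ , _ , eq = ⊥-elim (x∉σ (here (Listₚ.∷-injectiveˡ eq)))
  insertions-injective (a ∷ σ) (b ∷ τ) _   _   (here refl) (here eq)   = Listₚ.∷-injectiveʳ eq
  insertions-injective (a ∷ σ) (b ∷ τ) _   x∉τ (here refl) (there q)   with ∈-map⁻ (b ∷_) q
  ... | _ , _ , eq = ⊥-elim (x∉τ (here (Listₚ.∷-injectiveˡ eq)))
  insertions-injective (a ∷ σ) (b ∷ τ) x∉σ _   (there p)   (here refl) with ∈-map⁻ (a ∷_) p
  ... | _ , _ , eq = ⊥-elim (x∉σ (here (Listₚ.∷-injectiveˡ eq)))
  insertions-injective (a ∷ σ) (b ∷ τ) x∉σ x∉τ (there p)   (there q)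
    with ∈-map⁻ (a ∷_) p | ∈-map⁻ (b ∷_) q
  ... | w₁ , p₁ , refl | w₂ , q₂ , eq with Listₚ.∷-injective eq
  ... | refl , refl = cong (a ∷_) (insertions-injective σ τ (x∉σ ∘ there) (x∉τ ∘ there) p₁ q₂)

  ∈-words⁺ : ∀ k {A} w → length w ≡ k → All (_∈ A) w → w ∈ words k A
  ∈-words⁺ zero    []      _   _          = here refl
  ∈-words⁺ (suc k) {A} (x ∷ w) len (x∈A ∷ w⊆A) =
    ∈-concatMap⁺ (λ a → map (a ∷_) (words k A))
                 (Any.map (λ { refl → ∈-map⁺ (x ∷_) (∈-words⁺ k w (ℕ.suc-injective len) w⊆A) }) x∈A)

  ∈-words⁻ : ∀ k {A w} → w ∈ words k A → length w ≡ k × All (_∈ A) w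
  ∈-words⁻ zero    (here refl) = refl , []
  ∈-words⁻ (suc k) {A} w∈ with find (∈-concatMap⁻ (λ a → map (a ∷_) (words k A)) {xs = A} w∈)
  ... | a , a∈A , w∈a∷ with ∈-map⁻ (a ∷_) w∈a∷
  ... | w′ , w′∈ , refl with ∈-words⁻ k w′∈
  ... | len , w′⊆A = cong suc len , a∈A ∷ w′⊆A

  words-unique : ∀ k {A} → Unique A → Unique (words k A)
  words-unique zero    _    = [] ∷ []
  words-unique (suc k) {A} uniq = Uniqueₚ.concat⁺
    (Allₚ.map⁺ (All.tabulate (λ _ → Uniqueₚ.map⁺ Listₚ.∷-injectiveʳ (words-unique k uniq))))
    (AllPairsₚ.map⁺ (AllPairs.map disjoint uniq))
    where
    disjoint : ∀ {a b} → a ≢ b → Disjoint (map (a ∷_) (words k A)) (map (b ∷_) (words k A))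
    disjoint a≢b (p , q) with ∈-map⁻ _ p | ∈-map⁻ _ q
    ... | _ , _ , refl | _ , _ , eq = a≢b (Listₚ.∷-injectiveˡ eq)

  ∈-oneTo⁺ : ∀ {m x} → 1 ≤ x → x ≤ m → x ∈ oneTo m
  ∈-oneTo⁺ {x = suc y} _ y<m = ∈-map⁺ suc (∈-upTo⁺ y<m)

  ∈-oneTo⁻ : ∀ {m x} → x ∈ oneTo m → 1 ≤ x × x ≤ m
  ∈-oneTo⁻ x∈ with ∈-map⁻ suc x∈
  ... | y , y∈ , refl = s≤s z≤n , ∈-upTo⁻ y∈

  oneTo-unique : ∀ m → Unique (oneTo m)
  oneTo-unique m = Uniqueₚ.map⁺ ℕ.suc-injective (Uniqueₚ.upTo⁺ m)

  length-oneTo : ∀ m → length (oneTo m) ≡ m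
  length-oneTo m = ≡.trans (Listₚ.length-map suc (upTo m)) (Listₚ.length-upTo m)

  record IsPermutation (m : ℕ) (σ : List ℕ) : Set where
    field
      length≡ : length σ ≡ m
      letters : All (_∈ oneTo m) σ
      unique  : Unique σ

  ∈𝒮⁺ : ∀ {m σ} → IsPermutation m σ → σ ∈ 𝒮 m
  ∈𝒮⁺ {m} {σ} perm = ∈-filter⁺ unique? (∈-words⁺ m σ length≡ letters) unique
    where open IsPermutation perm

  ∈𝒮⁻ : ∀ {m σ} → σ ∈ 𝒮 m → IsPermutation m σ
  ∈𝒮⁻ {m} σ∈ with ∈-filter⁻ unique? {xs = words m (oneTo m)} σ∈
  ... | σ∈words , uniq with ∈-words⁻ m σ∈words
  ... | len , lett = record { length≡ = len ; letters = lett ; unique = uniq }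

  𝒮-unique : ∀ m → Unique (𝒮 m)
  𝒮-unique m = Uniqueₚ.filter⁺ unique? (words-unique m (oneTo-unique m))

  unique-⊆⇒length≤ : ∀ {xs ys : List ℕ} → Unique xs → xs ⊆ ys → length xs ≤ length ys
  unique-⊆⇒length≤ {[]}              _    _   = z≤n
  unique-⊆⇒length≤ {x ∷ xs} {[]}     _    xs⊆ with () ← xs⊆ (here refl)
  unique-⊆⇒length≤ {xs}     {y ∷ ys} uniq xs⊆ with y ∈? xs
  ... | no y∉xs = ℕ.m≤n⇒m≤1+n (unique-⊆⇒length≤ uniq xs⊆ys)
    where
    xs⊆ys : xs ⊆ ys
    xs⊆ys x∈ with xs⊆ x∈
    ... | here refl = ⊥-elim (y∉xs x∈)
    ... | there x∈ys = x∈ys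
  ... | yes y∈xs with ∈-∃++ y∈xs
  ... | u , v , refl with Unique-resp-↭ (↭⇒↭ₛ (shift y u v)) uniq
  ... | y∉uv ∷ uniq-uv = ≡.subst (_≤ suc (length ys)) (≡.sym (↭-length (shift y u v)))
                                (s≤s (unique-⊆⇒length≤ uniq-uv uv⊆ys))
    where
    uv⊆ys : u ++ v ⊆ ys
    uv⊆ys x∈ with xs⊆ (∈-resp-↭ (↭-sym (shift y u v)) (there x∈))
    ... | here refl  = ⊥-elim (All.lookup y∉uv x∈ refl)
    ... | there x∈ys = x∈ys

  ∈-oneTo-suc : ∀ {m x} → x ∈ oneTo m → x ∈ oneTo (suc m)
  ∈-oneTo-suc x∈ with ∈-oneTo⁻ x∈
  ... | 1≤x , x≤m = ∈-oneTo⁺ 1≤x (ℕ.m≤n⇒m≤1+n x≤m)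

  ∈-oneTo-pred : ∀ {m x} → x ∈ oneTo (suc m) → x ≢ suc m → x ∈ oneTo m
  ∈-oneTo-pred x∈ x≢ with ∈-oneTo⁻ x∈
  ... | 1≤x , x≤1+m = ∈-oneTo⁺ 1≤x (ℕ.≤-pred (ℕ.≤∧≢⇒< x≤1+m x≢))

  max∉ : ∀ {m σ} → IsPermutation m σ → suc m ∉ σ
  max∉ perm m+1∈σ = ℕ.1+n≰n (proj₂ (∈-oneTo⁻ (All.lookup (IsPermutation.letters perm) m+1∈σ)))

  max∈ : ∀ {m w} → IsPermutation (suc m) w → suc m ∈ w
  max∈ {m} {w} perm with suc m ∈? w
  ... | yes m+1∈w = m+1∈w
  ... | no  m+1∉w =
    ⊥-elim (ℕ.1+n≰n (≡.subst₂ _≤_ length≡ (length-oneTo m) (unique-⊆⇒length≤ unique w⊆)))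
    where
    open IsPermutation perm
    w⊆ : w ⊆ oneTo m
    w⊆ x∈ = ∈-oneTo-pred (All.lookup letters x∈) (λ { refl → m+1∉w x∈ })

  remove-max : ∀ {m} u v → IsPermutation (suc m) (u ++ suc m ∷ v) → IsPermutation m (u ++ v)
  remove-max {m} u v perm with Unique-resp-↭ (↭⇒↭ₛ (shift (suc m) u v)) (IsPermutation.unique perm)
  ... | m+1∉uv ∷ uniq = record
    { length≡ = ℕ.suc-injective (≡.trans (≡.sym (↭-length (shift (suc m) u v))) length≡)
    ; letters = All.tabulate (λ x∈ →
                  ∈-oneTo-pred (All.lookup letters (∈-resp-↭ (↭-sym (shift (suc m) u v)) (there x∈)))
                               (λ { refl → All.lookup m+1∉uv x∈ refl }))
    ; unique  = uniq
    }
    where open IsPermutation perm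

  insert-max : ∀ {m σ w} → IsPermutation m σ → w ∈ insertions (suc m) σ → IsPermutation (suc m) w
  insert-max {m} {σ} {w} perm w∈ = record
    { length≡ = ≡.trans (↭-length w↭) (cong suc length≡)
    ; letters = All-resp-↭ (↭-sym w↭) (∈-oneTo⁺ (s≤s z≤n) ℕ.≤-refl ∷ All.map ∈-oneTo-suc letters)
    ; unique  = Unique-resp-↭ (↭⇒↭ₛ (↭-sym w↭))
                  (All.tabulate (λ x∈σ eq → max∉ perm (≡.subst (_∈ σ) (≡.sym eq) x∈σ)) ∷ unique)
    }
    where
    open IsPermutation perm
    w↭ : w ↭ suc m ∷ σ
    w↭ = insertions-↭ σ w∈

  allPairs-restrict : ∀ {A : Set} {P : A → Set} {R S : A → A → Set} {xs} →
                      (∀ {x y} → P x → P y → R x y → S x y) → All P xs → AllPairs R xs → AllPairs S xs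
  allPairs-restrict f []         []         = []
  allPairs-restrict f (px ∷ pxs) (rx ∷ rxs) =
    All.zipWith (λ (py , r) → f px py r) (pxs , rx) ∷ allPairs-restrict f pxs rxs

  ∈-𝒮-suc⁻ : ∀ {m w} → w ∈ 𝒮 (suc m) → w ∈ concatMap (insertions (suc m)) (𝒮 m)
  ∈-𝒮-suc⁻ {m} w∈ with ∈-∃++ (max∈ {m} (∈𝒮⁻ w∈))
  ... | u , v , refl = ∈-concatMap⁺ (insertions (suc m))
                         (Any.map (λ { refl → ∈-insertions u v }) (∈𝒮⁺ (remove-max u v (∈𝒮⁻ w∈))))

  ∈-𝒮-suc⁺ : ∀ {m w} → w ∈ concatMap (insertions (suc m)) (𝒮 m) → w ∈ 𝒮 (suc m)
  ∈-𝒮-suc⁺ {m} w∈ with find (∈-concatMap⁻ (insertions (suc m)) {xs = 𝒮 m} w∈)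
  ... | σ , σ∈ , w∈ins = ∈𝒮⁺ (insert-max (∈𝒮⁻ σ∈) w∈ins)

  insertions-of-𝒮-unique : ∀ m → Unique (concatMap (insertions (suc m)) (𝒮 m))
  insertions-of-𝒮-unique m = Uniqueₚ.concat⁺
    (Allₚ.map⁺ (All.tabulate (λ {σ} σ∈ → insertions-unique σ (fresh σ∈))))
    (AllPairsₚ.map⁺ (allPairs-restrict
      (λ {σ} {τ} m+1∉σ m+1∉τ σ≢τ (p , q) → σ≢τ (insertions-injective σ τ m+1∉σ m+1∉τ p q))
      (All.tabulate fresh) (𝒮-unique m)))
    where
    fresh : ∀ {σ} → σ ∈ 𝒮 m → suc m ∉ σ
    fresh σ∈ = max∉ (∈𝒮⁻ σ∈)

  𝒮-suc-↭ : ∀ m → 𝒮 (suc m) ↭ concatMap (insertions (suc m)) (𝒮 m)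
  𝒮-suc-↭ m = ∼bag⇒↭ (unique∧set⇒bag (𝒮-unique (suc m)) (insertions-of-𝒮-unique m)
                                      (mk⇔ (∈-𝒮-suc⁻ {m}) (∈-𝒮-suc⁺ {m})))

module Recurrence where
  open Polynomials
  open Permutations
  open import Data.Integer using (+_; _+_; _-_; _*_)
  import Data.Integer.Properties as ℤ
  open import Data.Integer.Tactic.RingSolver using (solve-∀)
  open import Data.List using (length; filter)
  open import Data.List.Membership.Propositional using (find)
  open import Data.List.Membership.Propositional.Properties using (∈-concatMap⁻)
  open import Data.List.Relation.Unary.All as All using (All; []; _∷_)
  open import Data.List.Relation.Binary.Permutation.Propositional.Properties as ↭ using ()
  open import Data.Nat.ListAction using (sum)
  open import Data.Nat.ListAction.Properties using (sum-↭)
  open import Function.Bundles using (Equivalence)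
  open import Relation.Nullary using (Dec; does)
  open import Relation.Nullary.Decidable using (_×-dec_)

  <ᵇ-true : ∀ {m n} → m ℕ.< n → (m <ᵇ n) ≡ true
  <ᵇ-true m<n = Equivalence.to Bool.T-≡ (ℕ.<⇒<ᵇ m<n)

  <ᵇ-false : ∀ {m n} → n ≤ m → (m <ᵇ n) ≡ false
  <ᵇ-false {m} {n} n≤m =
    Bool.¬-not (λ m<ᵇn → ℕ.<⇒≱ (ℕ.<ᵇ⇒< m n (Equivalence.from Bool.T-≡ m<ᵇn)) n≤m)

  -- Weak ascents σᵢ ≤ σᵢ₊₁ into an even letter (ascents, for words without repeated letters).
  ascE : List ℕ → ℕ
  ascE []          = 0
  ascE (a ∷ [])    = 0
  ascE (a ∷ b ∷ σ) = bit (not (b <ᵇ a) ∧ isEven b) ℕ.+ ascE (b ∷ σ)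

  evens : List ℕ → ℕ
  evens σ = sum (map (bit ∘ isEven) σ)

  desE+ascE≡evens : ∀ a τ → desE (a ∷ τ) ℕ.+ ascE (a ∷ τ) ≡ evens τ
  desE+ascE≡evens a []      = refl
  desE+ascE≡evens a (b ∷ τ) with desE+ascE≡evens b τ | b <ᵇ a | isEven b
  ... | ih | true  | true  = cong suc ih
  ... | ih | true  | false = ih
  ... | ih | false | true  = ≡.trans (ℕ.+-suc (desE (b ∷ τ)) (ascE (b ∷ τ))) (cong suc ih)
  ... | ih | false | false = ih

  evens-↭ : ∀ {σ τ} → σ ↭ τ → evens σ ≡ evens τ
  evens-↭ σ↭τ = sum-↭ (↭.map⁺ (bit ∘ isEven) σ↭τ)

  ⌊1+m/2⌋ : ∀ m → ⌊ suc m /2⌋ ≡ bit (isEven (suc m)) ℕ.+ ⌊ m /2⌋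
  ⌊1+m/2⌋ zero          = refl
  ⌊1+m/2⌋ (suc zero)    = refl
  ⌊1+m/2⌋ (suc (suc m)) = ≡.trans (cong suc (⌊1+m/2⌋ m)) (≡.sym (ℕ.+-suc _ _))

  evens-𝒮 : ∀ m {σ} → σ ∈ 𝒮 m → evens σ ≡ ⌊ m /2⌋
  evens-𝒮 zero    (here refl) = refl
  evens-𝒮 (suc m) {w} w∈ with find (∈-concatMap⁻ (insertions (suc m)) {xs = 𝒮 m} (∈-𝒮-suc⁻ {m} w∈))
  ... | σ , σ∈ , w∈ins = begin
    evens w                                  ≡⟨ evens-↭ (insertions-↭ σ w∈ins) ⟩
    bit (isEven (suc m)) ℕ.+ evens σ         ≡⟨ cong (bit (isEven (suc m)) ℕ.+_) (evens-𝒮 m σ∈) ⟩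
    bit (isEven (suc m)) ℕ.+ ⌊ m /2⌋         ≡⟨ ⌊1+m/2⌋ m ⟨
    ⌊ suc m /2⌋                              ∎
    where open ≡.≡-Reasoning

  isEven-2* : ∀ n → isEven (2 ℕ.* n) ≡ true
  isEven-2* zero    = refl
  isEven-2* (suc n) = ≡.subst (λ k → isEven k ≡ true) (≡.sym (ℕ.*-suc 2 n)) (isEven-2* n)

  isEven-1+2* : ∀ n → isEven (suc (2 ℕ.* n)) ≡ false
  isEven-1+2* zero    = refl
  isEven-1+2* (suc n) = ≡.subst (λ k → isEven (suc k) ≡ false) (≡.sym (ℕ.*-suc 2 n)) (isEven-1+2* n)

  ⌊2*n/2⌋ : ∀ n → ⌊ 2 ℕ.* n /2⌋ ≡ n
  ⌊2*n/2⌋ zero    = refl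
  ⌊2*n/2⌋ (suc n) = ≡.subst (λ k → ⌊ k /2⌋ ≡ suc n) (≡.sym (ℕ.*-suc 2 n)) (cong suc (⌊2*n/2⌋ n))

  ⌊1+2*n/2⌋ : ∀ n → ⌊ suc (2 ℕ.* n) /2⌋ ≡ n
  ⌊1+2*n/2⌋ zero    = refl
  ⌊1+2*n/2⌋ (suc n) = ≡.subst (λ k → ⌊ suc k /2⌋ ≡ suc n) (≡.sym (ℕ.*-suc 2 n)) (cong suc (⌊1+2*n/2⌋ n))

  count-step-flat : ∀ S m m⁺ (k A : ℕ) → S ⊕ + A ⋆ m ≈ + k ⋆ m ⊕ + A ⋆ m⁺ →
                    (m ⊕ S) ⊕ + A ⋆ m ≈ + suc k ⋆ m ⊕ + A ⋆ m⁺
  count-step-flat S m m⁺ k A counted i j = begin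
    (m i j + S i j) + + A * m i j      ≡⟨ ℤ.+-assoc (m i j) (S i j) _ ⟩
    m i j + (S i j + + A * m i j)      ≡⟨ cong (λ s → m i j + s) (counted i j) ⟩
    m i j + (+ k * m i j + + A * m⁺ i j) ≡⟨ ring (m i j) (m⁺ i j) (+ k) (+ A) ⟩
    (+ 1 + + k) * m i j + + A * m⁺ i j ∎
    where
    open ≡.≡-Reasoning
    ring : ∀ m m⁺ k A → m + (k * m + A * m⁺) ≡ (+ 1 + k) * m + A * m⁺
    ring = solve-∀

  count-step-raised : ∀ S m m⁺ (k A : ℕ) → S ⊕ + A ⋆ m ≈ + k ⋆ m ⊕ + A ⋆ m⁺ →
                      (m⁺ ⊕ S) ⊕ + suc A ⋆ m ≈ + suc k ⋆ m ⊕ + suc A ⋆ m⁺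
  count-step-raised S m m⁺ k A counted i j = begin
    (m⁺ i j + S i j) + (+ 1 + + A) * m i j         ≡⟨ ring₁ (m⁺ i j) (S i j) (m i j) (+ A) ⟩
    (m⁺ i j + m i j) + (S i j + + A * m i j)       ≡⟨ cong (λ s → (m⁺ i j + m i j) + s) (counted i j) ⟩
    (m⁺ i j + m i j) + (+ k * m i j + + A * m⁺ i j) ≡⟨ ring₂ (m i j) (m⁺ i j) (+ k) (+ A) ⟩
    (+ 1 + + k) * m i j + (+ 1 + + A) * m⁺ i j     ∎
    where
    open ≡.≡-Reasoning
    ring₁ : ∀ m⁺ s m A → (m⁺ + s) + (+ 1 + A) * m ≡ (m⁺ + m) + (s + A * m)
    ring₁ = solve-∀
    ring₂ : ∀ m m⁺ k A → (m⁺ + m) + (k * m + A * m⁺) ≡ (+ 1 + k) * m + (+ 1 + A) * m⁺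
    ring₂ = solve-∀

  mulX-count : ∀ {S} d e (k A : ℕ) → S ⊕ + A ⋆ mono d e ≈ + k ⋆ mono d e ⊕ + A ⋆ mono (suc d) e →
               mulX S ⊕ + A ⋆ mono (suc d) e ≈ + k ⋆ mono (suc d) e ⊕ + A ⋆ mono (suc (suc d)) e
  mulX-count {S} d e k A counted = begin
    mulX S ⊕ + A ⋆ mono (suc d) e                       ≈⟨ ⊕-congˡ (mulX S) (mulX-⋆-mono (+ A) d e) ⟨
    mulX S ⊕ mulX (+ A ⋆ mono d e)                      ≈⟨ ⊕-homo mulX-additive S _ ⟨
    mulX (S ⊕ + A ⋆ mono d e)                           ≈⟨ ≈-cong mulX-additive counted ⟩
    mulX (+ k ⋆ mono d e ⊕ + A ⋆ mono (suc d) e)        ≈⟨ ⊕-homo mulX-additive _ _ ⟩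
    mulX (+ k ⋆ mono d e) ⊕ mulX (+ A ⋆ mono (suc d) e) ≈⟨ ⊕-cong (mulX-⋆-mono (+ k) d e) (mulX-⋆-mono (+ A) (suc d) e) ⟩
    + k ⋆ mono (suc d) e ⊕ + A ⋆ mono (suc (suc d)) e   ∎
    where open ≈-Reasoning

  ∑-mono-suc : ∀ {A : Set} (ws : List A) (deg : A → ℕ) e →
               ∑ ws (λ w → mono (suc (deg w)) e) ≈ mulX (∑ ws (λ w → mono (deg w) e))
  ∑-mono-suc ws deg e = ≈-trans (∑-cong ws (λ _ → ≈-sym (mulX-mono _ e))) (≈-sym (∑-homo mulX-additive ws _))

  count-step : ∀ {X : Set} (ws : List X) (deg : X → ℕ) D e ℓ A (descent even : Bool) →
    let S = ∑ ws (λ w → mono (deg w) e) ; δ = bit (descent ∧ even) ; ε = bit (not descent ∧ even) in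
    S ⊕ + A ⋆ mono D e ≈ + suc ℓ ⋆ mono D e ⊕ + A ⋆ mono (suc D) e →
    (mono (bit even ℕ.+ D) e ⊕ ∑ ws (λ w → mono (δ ℕ.+ deg w) e)) ⊕ + (ε ℕ.+ A) ⋆ mono (δ ℕ.+ D) e
      ≈ + suc (suc ℓ) ⋆ mono (δ ℕ.+ D) e ⊕ + (ε ℕ.+ A) ⋆ mono (suc (δ ℕ.+ D)) e
  count-step ws deg D e ℓ A true  true  counted =
    count-step-flat (∑ ws (λ w → mono (suc (deg w)) e)) (mono (suc D) e) (mono (suc (suc D)) e) (suc ℓ) A
      (≈-trans (⊕-congʳ (+ A ⋆ mono (suc D) e) (∑-mono-suc ws deg e)) (mulX-count D e (suc ℓ) A counted))
  count-step ws deg D e ℓ A true  false counted =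
    count-step-flat (∑ ws (λ w → mono (deg w) e)) (mono D e) (mono (suc D) e) (suc ℓ) A counted
  count-step ws deg D e ℓ A false true  counted =
    count-step-raised (∑ ws (λ w → mono (deg w) e)) (mono D e) (mono (suc D) e) (suc ℓ) A counted
  count-step ws deg D e ℓ A false false counted =
    count-step-flat (∑ ws (λ w → mono (deg w) e)) (mono D e) (mono (suc D) e) (suc ℓ) A counted

  -- Of the |τ| + 1 insertions after the head, exactly ascE (a ∷ τ) raise desE; stated without subtraction.
  insert-after-head : ∀ {L} a τ → All (ℕ._< L) (a ∷ τ) → ∀ e → let d = desE (a ∷ τ) ; A = ascE (a ∷ τ) in
    ∑ (insertions L τ) (λ w → mono (desE (a ∷ w)) e) ⊕ + A ⋆ mono d e
      ≈ + suc (length τ) ⋆ mono d e ⊕ + A ⋆ mono (suc d) e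
  insert-after-head {L} a [] (a<L ∷ []) e rewrite <ᵇ-false {L} {a} (ℕ.<⇒≤ a<L) =
    λ i j → ring (mono 0 e i j) (mono 1 e i j)
    where
    ring : ∀ m m⁺ → (m + + 0) + + 0 * m ≡ + 1 * m + + 0 * m⁺
    ring = solve-∀
  insert-after-head {L} a (b ∷ τ) (a<L ∷ b<L ∷ τ<L) e rewrite <ᵇ-false {L} {a} (ℕ.<⇒≤ a<L) | <ᵇ-true b<L =
    ≈-trans (⊕-congʳ (+ ascE (a ∷ b ∷ τ) ⋆ mono (desE (a ∷ b ∷ τ)) e)
                     (⊕-congˡ (mono (bit (isEven b) ℕ.+ desE (b ∷ τ)) e)
                              (∑-map (b ∷_) (insertions L τ) (λ w → mono (desE (a ∷ w)) e))))
            (count-step (insertions L τ) (λ w → desE (b ∷ w)) (desE (b ∷ τ)) e (length τ) (ascE (b ∷ τ))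
                        (b <ᵇ a) (isEven b) (insert-after-head b τ (b<L ∷ τ<L) e))

  weight : List ℕ → Poly
  weight σ = mono (desE σ) (χfirstEven σ)

  length-filter-∷ : ∀ {X : Set} {Q : X → Set} (Q? : (x : X) → Dec (Q x)) x xs →
                    length (filter Q? (x ∷ xs)) ≡ bit (does (Q? x)) ℕ.+ length (filter Q? xs)
  length-filter-∷ Q? x xs with does (Q? x)
  ... | true  = refl
  ... | false = refl

  P≈∑weight : ∀ m → P m ≈ ∑ (𝒮 m) weight
  P≈∑weight m i j = count (𝒮 m)
    where
    test : (σ : List ℕ) → Dec (desE σ ≡ i × χfirstEven σ ≡ j)
    test σ = (desE σ ℕ.≟ i) ×-dec (χfirstEven σ ℕ.≟ j)
    bit-+ : ∀ c → + bit c ≡ (if c then + 1 else + 0)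
    bit-+ true  = refl
    bit-+ false = refl
    count : ∀ σs → + length (filter test σs) ≡ ∑ σs weight i j
    count []       = refl
    count (σ ∷ σs) = begin
      + length (filter test (σ ∷ σs))                      ≡⟨ cong +_ (length-filter-∷ test σ σs) ⟩
      + (bit (does (test σ)) ℕ.+ length (filter test σs))  ≡⟨ ℤ.pos-+ (bit (does (test σ))) _ ⟩
      + bit (does (test σ)) + + length (filter test σs)    ≡⟨ cong₂ _+_ (bit-+ (does (test σ))) (count σs) ⟩
      weight σ i j + ∑ σs weight i j                       ∎
      where open ≡.≡-Reasoning

  ∑-insertions-head : ∀ {L} a τ → a ℕ.< L →
    ∑ (insertions L (a ∷ τ)) weight
      ≈ mono (χfirstEven (a ∷ τ) ℕ.+ desE (a ∷ τ)) (bit (isEven L))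
        ⊕ ∑ (insertions L τ) (λ w → mono (desE (a ∷ w)) (χfirstEven (a ∷ τ)))
  ∑-insertions-head {L} a τ a<L rewrite <ᵇ-true a<L =
    ⊕-congˡ (mono (χfirstEven (a ∷ τ) ℕ.+ desE (a ∷ τ)) (bit (isEven L))) (∑-map (a ∷_) (insertions L τ) weight)

  letters<max : ∀ {m σ} → IsPermutation m σ → All (ℕ._< suc m) σ
  letters<max perm = All.map (λ x∈ → s≤s (proj₂ (∈-oneTo⁻ x∈))) (IsPermutation.letters perm)

  desE+ascE+χ : ∀ {m} a τ → a ∷ τ ∈ 𝒮 m → desE (a ∷ τ) ℕ.+ ascE (a ∷ τ) ℕ.+ χfirstEven (a ∷ τ) ≡ ⌊ m /2⌋
  desE+ascE+χ {m} a τ σ∈ = begin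
    desE (a ∷ τ) ℕ.+ ascE (a ∷ τ) ℕ.+ χfirstEven (a ∷ τ) ≡⟨ cong (ℕ._+ χfirstEven (a ∷ τ)) (desE+ascE≡evens a τ) ⟩
    evens τ ℕ.+ χfirstEven (a ∷ τ)                       ≡⟨ ℕ.+-comm (evens τ) _ ⟩
    evens (a ∷ τ)                                        ≡⟨ evens-𝒮 m σ∈ ⟩
    ⌊ m /2⌋                                              ∎
    where open ≡.≡-Reasoning

  -- The front insertion is matched by x ∂z xᵈz when σ₁ is even and by the constant term otherwise.
  -- The ring identities are stated in the shape the goals unfold to: 2 ℕ.* n is n + (n + 0).
  odd-arithmetic : ∀ d A b → let e = bit b ; n = d ℕ.+ A ℕ.+ e ; m = mono d e ; m⁺ = mono (suc d) e in
    mono (e ℕ.+ d) 0 ⊕ (+ (2 ℕ.* n) ⋆ m ⊕ + A ⋆ m⁺)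
      ≈ (+ d ⋆ m ⊖ + d ⋆ m⁺) ⊕ (mulX (∂z m) ⊖ + e ⋆ m⁺) ⊕ (m ⊕ + n ⋆ (m ⊕ m⁺)) ⊕ + A ⋆ m
  odd-arithmetic d A false i j rewrite x∂z-mono-zero d i j =
    ring (+ d) (+ A) (mono d 0 i j) (mono (suc d) 0 i j)
    where
    ring : ∀ D A m m⁺ → let N = D + A + + 0 in
           m + ((N + (N + + 0)) * m + A * m⁺)
             ≡ ((D * m - D * m⁺) + (+ 0 - + 0 * m⁺) + (m + N * (m + m⁺))) + A * m
    ring = solve-∀
  odd-arithmetic d A true i j rewrite x∂z-mono-one d i j =
    ring (+ d) (+ A) (mono d 1 i j) (mono (suc d) 1 i j) (mono (suc d) 0 i j)
    where
    ring : ∀ D A m m⁺ f → let N = D + A + + 1 in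
           f + ((N + (N + + 0)) * m + A * m⁺)
             ≡ ((D * m - D * m⁺) + (+ 1 * f - + 1 * m⁺) + (m + N * (m + m⁺))) + A * m
    ring = solve-∀

  oddRecurrence-on-insertions : ∀ {S} n d A b → let e = bit b in
    d ℕ.+ A ℕ.+ e ≡ n →
    S ⊕ + A ⋆ mono d e ≈ + (2 ℕ.* n) ⋆ mono d e ⊕ + A ⋆ mono (suc d) e →
    mono (e ℕ.+ d) 0 ⊕ S ≈ oddRecurrence n (mono d e)
  oddRecurrence-on-insertions {S} _ d A b refl counted = ⊕-cancelʳ (+ A ⋆ m) (begin
    (F ⊕ S) ⊕ + A ⋆ m                                ≈⟨ (λ i j → ℤ.+-assoc (F i j) (S i j) _) ⟩
    F ⊕ (S ⊕ + A ⋆ m)                                ≈⟨ ⊕-congˡ F counted ⟩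
    F ⊕ (+ (2 ℕ.* n) ⋆ m ⊕ + A ⋆ mono (suc d) e)     ≈⟨ odd-arithmetic d A b ⟩
    (+ d ⋆ m ⊖ + d ⋆ mono (suc d) e) ⊕ (mulX (∂z m) ⊖ + e ⋆ mono (suc d) e)
      ⊕ (m ⊕ + n ⋆ (m ⊕ mono (suc d) e)) ⊕ + A ⋆ m   ≈⟨ ⊕-congʳ (+ A ⋆ m) (oddRecurrence-mono n d e) ⟨
    oddRecurrence n m ⊕ + A ⋆ m                      ∎)
    where
    open ≈-Reasoning
    e n : ℕ
    e = bit b
    n = d ℕ.+ A ℕ.+ e
    m F : Poly
    m = mono d e
    F = mono (e ℕ.+ d) 0

  even-arithmetic : ∀ d A b →
    let e = bit b ; n = d ℕ.+ A ℕ.+ e ; m = mono d e ; m⁺ = mono (suc d) e ; mᶻ = mono d (suc e) in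
    mono (e ℕ.+ d) 1 ⊕ (+ suc (2 ℕ.* n) ⋆ m ⊕ + A ⋆ m⁺)
      ≈ (+ d ⋆ m ⊖ + d ⋆ m⁺) ⊕ (+ e ⋆ m ⊖ + e ⋆ mᶻ) ⊕ (m ⊕ mᶻ ⊕ + n ⋆ (m ⊕ m⁺)) ⊕ + A ⋆ m
  even-arithmetic d A false i j =
    ring (+ d) (+ A) (mono d 0 i j) (mono (suc d) 0 i j) (mono d 1 i j)
    where
    ring : ∀ D A m m⁺ mᶻ → let N = D + A + + 0 in
           mᶻ + ((+ 1 + (N + (N + + 0))) * m + A * m⁺)
             ≡ ((D * m - D * m⁺) + (+ 0 * m - + 0 * mᶻ) + (m + mᶻ + N * (m + m⁺))) + A * m
    ring = solve-∀
  even-arithmetic d A true i j =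
    ring (+ d) (+ A) (mono d 1 i j) (mono (suc d) 1 i j) (mono d 2 i j)
    where
    ring : ∀ D A m m⁺ mᶻ → let N = D + A + + 1 in
           m⁺ + ((+ 1 + (N + (N + + 0))) * m + A * m⁺)
             ≡ ((D * m - D * m⁺) + (+ 1 * m - + 1 * mᶻ) + (m + mᶻ + N * (m + m⁺))) + A * m
    ring = solve-∀

  evenRecurrence-on-insertions : ∀ {S} n d A b → let e = bit b in
    d ℕ.+ A ℕ.+ e ≡ n →
    S ⊕ + A ⋆ mono d e ≈ + suc (2 ℕ.* n) ⋆ mono d e ⊕ + A ⋆ mono (suc d) e →
    mono (e ℕ.+ d) 1 ⊕ S ≈ evenRecurrence n (mono d e)
  evenRecurrence-on-insertions {S} _ d A b refl counted = ⊕-cancelʳ (+ A ⋆ m) (begin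
    (F ⊕ S) ⊕ + A ⋆ m                                 ≈⟨ (λ i j → ℤ.+-assoc (F i j) (S i j) _) ⟩
    F ⊕ (S ⊕ + A ⋆ m)                                 ≈⟨ ⊕-congˡ F counted ⟩
    F ⊕ (+ suc (2 ℕ.* n) ⋆ m ⊕ + A ⋆ mono (suc d) e)  ≈⟨ even-arithmetic d A b ⟩
    (+ d ⋆ m ⊖ + d ⋆ mono (suc d) e) ⊕ (+ e ⋆ m ⊖ + e ⋆ mono d (suc e))
      ⊕ (m ⊕ mono d (suc e) ⊕ + n ⋆ (m ⊕ mono (suc d) e)) ⊕ + A ⋆ m
                                                      ≈⟨ ⊕-congʳ (+ A ⋆ m) (evenRecurrence-mono n d e) ⟨
    evenRecurrence n m ⊕ + A ⋆ m                      ∎)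
    where
    open ≈-Reasoning
    e n : ℕ
    e = bit b
    n = d ℕ.+ A ℕ.+ e
    m F : Poly
    m = mono d e
    F = mono (e ℕ.+ d) 1

  module _ {m a τ} (σ∈ : a ∷ τ ∈ 𝒮 m) where
    private
      perm : IsPermutation m (a ∷ τ)
      perm = ∈𝒮⁻ σ∈
      d A e : ℕ
      d = desE (a ∷ τ)
      A = ascE (a ∷ τ)
      e = χfirstEven (a ∷ τ)
      S : Poly
      S = ∑ (insertions (suc m) τ) (λ w → mono (desE (a ∷ w)) e)

    insertions-split : ∑ (insertions (suc m) (a ∷ τ)) weight ≈ mono (e ℕ.+ d) (bit (isEven (suc m))) ⊕ S
    insertions-split = ∑-insertions-head {suc m} a τ (All.head (letters<max perm))

    insertions-counted : S ⊕ + A ⋆ mono d e ≈ + m ⋆ mono d e ⊕ + A ⋆ mono (suc d) e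
    insertions-counted = ≡.subst (λ k → S ⊕ + A ⋆ mono d e ≈ + k ⋆ mono d e ⊕ + A ⋆ mono (suc d) e)
                                 (IsPermutation.length≡ perm) (insert-after-head {suc m} a τ (letters<max perm) e)

  insertions-odd : ∀ n → 1 ≤ n → ∀ {σ} → σ ∈ 𝒮 (2 ℕ.* n) →
                   ∑ (insertions (suc (2 ℕ.* n)) σ) weight ≈ oddRecurrence n (weight σ)
  insertions-odd zero    ()
  insertions-odd (suc n) _ {[]} σ∈ with () ← IsPermutation.length≡ (∈𝒮⁻ {2 ℕ.* suc n} σ∈)
  insertions-odd n       _ {a ∷ τ} σ∈ = begin
    ∑ (insertions (suc (2 ℕ.* n)) (a ∷ τ)) weight ≈⟨ insertions-split {2 ℕ.* n} σ∈ ⟩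
    mono (e ℕ.+ d) (bit (isEven (suc (2 ℕ.* n)))) ⊕ S
                                                  ≡⟨ cong (λ c → mono (e ℕ.+ d) (bit c) ⊕ S) (isEven-1+2* n) ⟩
    mono (e ℕ.+ d) 0 ⊕ S                          ≈⟨ oddRecurrence-on-insertions n d (ascE (a ∷ τ)) (isEven a)
                                                       (≡.trans (desE+ascE+χ a τ σ∈) (⌊2*n/2⌋ n))
                                                       (insertions-counted {2 ℕ.* n} σ∈) ⟩
    oddRecurrence n (weight (a ∷ τ))              ∎
    where
    open ≈-Reasoning
    d e : ℕ
    d = desE (a ∷ τ)
    e = χfirstEven (a ∷ τ)
    S : Poly
    S = ∑ (insertions (suc (2 ℕ.* n)) τ) (λ w → mono (desE (a ∷ w)) e)

  insertions-even : ∀ n {σ} → σ ∈ 𝒮 (suc (2 ℕ.* n)) →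
                    ∑ (insertions (suc (suc (2 ℕ.* n))) σ) weight ≈ evenRecurrence n (weight σ)
  insertions-even n {[]} σ∈ with () ← IsPermutation.length≡ (∈𝒮⁻ {suc (2 ℕ.* n)} σ∈)
  insertions-even n {a ∷ τ} σ∈ = begin
    ∑ (insertions (suc (suc (2 ℕ.* n))) (a ∷ τ)) weight ≈⟨ insertions-split {suc (2 ℕ.* n)} σ∈ ⟩
    mono (e ℕ.+ d) (bit (isEven (2 ℕ.* n))) ⊕ S
                                                  ≡⟨ cong (λ c → mono (e ℕ.+ d) (bit c) ⊕ S) (isEven-2* n) ⟩
    mono (e ℕ.+ d) 1 ⊕ S                          ≈⟨ evenRecurrence-on-insertions n d (ascE (a ∷ τ)) (isEven a)
                                                       (≡.trans (desE+ascE+χ a τ σ∈) (⌊1+2*n/2⌋ n))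
                                                       (insertions-counted {suc (2 ℕ.* n)} σ∈) ⟩
    evenRecurrence n (weight (a ∷ τ))             ∎
    where
    open ≈-Reasoning
    d e : ℕ
    d = desE (a ∷ τ)
    e = χfirstEven (a ∷ τ)
    S : Poly
    S = ∑ (insertions (suc (suc (2 ℕ.* n))) τ) (λ w → mono (desE (a ∷ w)) e)

  recurrence-step : ∀ m {Op} → Additive Op →
                    (∀ {σ} → σ ∈ 𝒮 m → ∑ (insertions (suc m) σ) weight ≈ Op (weight σ)) →
                    P (suc m) ≈ Op (P m)
  recurrence-step m {Op} additive per-permutation = begin
    P (suc m)                                           ≈⟨ P≈∑weight (suc m) ⟩
    ∑ (𝒮 (suc m)) weight                                ≈⟨ ∑-↭ weight (𝒮-suc-↭ m) ⟩
    ∑ (concatMap (insertions (suc m)) (𝒮 m)) weight     ≈⟨ ∑-concatMap (insertions (suc m)) (𝒮 m) weight ⟩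
    ∑ (𝒮 m) (λ σ → ∑ (insertions (suc m) σ) weight)     ≈⟨ ∑-cong (𝒮 m) per-permutation ⟩
    ∑ (𝒮 m) (Op ∘ weight)                               ≈⟨ ∑-homo additive (𝒮 m) weight ⟨
    Op (∑ (𝒮 m) weight)                                 ≈⟨ ≈-cong additive (P≈∑weight m) ⟨
    Op (P m)                                            ∎
    where open ≈-Reasoning

  P₁ : P 1 ≈ 𝟙
  P₁ zero    zero    = refl
  P₁ zero    (suc j) = refl
  P₁ (suc i) zero    = refl
  P₁ (suc i) (suc j) = refl

  P₂ : P 2 ≈ 𝟙 ⊕ Z
  P₂ zero    zero          = refl
  P₂ zero    (suc zero)    = refl
  P₂ zero    (suc (suc j)) = refl
  P₂ (suc i) zero          = refl
  P₂ (suc i) (suc j)       = refl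

  P-odd : ∀ n → 1 ≤ n → P (suc (2 ℕ.* n)) ≈ oddRecurrence n (P (2 ℕ.* n))
  P-odd n 1≤n = recurrence-step (2 ℕ.* n) (oddRecurrence-additive n) (insertions-odd n 1≤n)

  P-even : ∀ n → P (suc (suc (2 ℕ.* n))) ≈ evenRecurrence n (P (suc (2 ℕ.* n)))
  P-even n = recurrence-step (suc (2 ℕ.* n)) (evenRecurrence-additive n) (insertions-even n)

open Polynomials
open Recurrence
open import Data.Nat using (ℕ; _≤_; _+_; _*_)
open import Data.Integer using (+_)
open import Data.Product using (_×_)

odd-recurrence : ∀ n → 1 ≤ n →
  P (2 * n + 1) ≈ X ⊛ (𝟙 ⊖ X) ⊛ ∂x (P (2 * n)) ⊕ X ⊛ (𝟙 ⊖ Z) ⊛ ∂z (P (2 * n))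
                    ⊕ (𝟙 ⊕ const (+ n) ⊛ (𝟙 ⊕ X)) ⊛ P (2 * n)
odd-recurrence n 1≤n = begin
  P (2 * n + 1)                ≡⟨ cong P (ℕ.+-comm (2 * n) 1) ⟩
  P (suc (2 * n))              ≈⟨ P-odd n 1≤n ⟩
  oddRecurrence n (P (2 * n))  ≈⟨ oddRecurrence-⊛ n (P (2 * n)) ⟨
  _                            ∎
  where open ≈-Reasoning

even-recurrence : ∀ n →
  P (2 * n + 2) ≈ X ⊛ (𝟙 ⊖ X) ⊛ ∂x (P (2 * n + 1)) ⊕ Z ⊛ (𝟙 ⊖ Z) ⊛ ∂z (P (2 * n + 1))
                    ⊕ (𝟙 ⊕ Z ⊕ const (+ n) ⊛ (𝟙 ⊕ X)) ⊛ P (2 * n + 1)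
even-recurrence n = begin
  P (2 * n + 2)                       ≡⟨ cong P (ℕ.+-comm (2 * n) 2) ⟩
  P (suc (suc (2 * n)))               ≈⟨ P-even n ⟩
  evenRecurrence n (P (suc (2 * n)))  ≈⟨ ≈-cong (evenRecurrence-additive n) (≡⇒≈ (cong P (ℕ.+-comm 1 (2 * n)))) ⟩
  evenRecurrence n (P (2 * n + 1))    ≈⟨ evenRecurrence-⊛ n (P (2 * n + 1)) ⟨
  _                                   ∎
  where open ≈-Reasoning

corollary4p2 : P 1 ≈ 𝟙 × P 2 ≈ 𝟙 ⊕ Z
    × (∀ (n : ℕ) → 1 ≤ n →
        (P (2 * n + 1) ≈ X ⊛ (𝟙 ⊖ X) ⊛ ∂x (P (2 * n)) ⊕ X ⊛ (𝟙 ⊖ Z) ⊛ ∂z (P (2 * n))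
                          ⊕ (𝟙 ⊕ const (+ n) ⊛ (𝟙 ⊕ X)) ⊛ P (2 * n))
        × (P (2 * n + 2) ≈ X ⊛ (𝟙 ⊖ X) ⊛ ∂x (P (2 * n + 1)) ⊕ Z ⊛ (𝟙 ⊖ Z) ⊛ ∂z (P (2 * n + 1))
                          ⊕ (𝟙 ⊕ Z ⊕ const (+ n) ⊛ (𝟙 ⊕ X)) ⊛ P (2 * n + 1)))
corollary4p2 = P₁ , P₂ , λ n 1≤n → odd-recurrence n 1≤n , even-recurrence n
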